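{- Let $\Psi$ be a weighted directed graph with finite vertex set ${\tt N}$ and let $\aleph$ be a partition of ${\tt N}$. Let $F\in{\cal F}^k(\Psi)$ be tree-divisible by $\aleph$. Then $F$ has a unique representative $F'$, and $F'\in{\cal F}^k(\Psi|\aleph)$.
   Context: An entering forest is a directed graph in which at most one arc leaves each vertex and there are no directed cycles; its components are entering trees, whose root is the unique vertex with no outgoing arc. ${\cal F}^k(G)$ denotes the set of spanning entering forests of a directed graph $G$ (subgraphs of $G$ with vertex set ${\tt V}G$) consisting of exactly $k$ trees. $G|_{\tt D}$ is the subgraph of $G$ induced by ${\tt D}$. For a directed graph $G$ with vertex set ${\tt N}$ (a spanning subgraph of $\Psi$) and ${\tt D}\subseteq{\tt N}$: ${\cal T}^\bullet_{\tt D}(G)$ is the set of entering trees that are subgraphs of $G$ with vertex set ${\tt D}$; ${\cal T}^\circ_{\tt D}(G)$ is the set of entering trees $T\subseteq G$ with ${\tt D}\subset{\tt V}T$, $|{\tt V}T|=|{\tt D}|+1$ and $T|_{\tt D}\in{\cal T}^\bullet_{\tt D}(G)$. For distinct ${\tt X},{\tt Y}\in\aleph$, ${\cal T}_{\tt XY}(G)$ is the set of $T\in{\cal T}^\circ_{\tt X}(G)$ whose root lies in ${\tt Y}$. $G$ is tree-divisible by $\aleph$ if ${\cal T}^\bullet_{\tt X}(G)\ne\emptyset$ for all ${\tt X}\in\aleph$; if some spanning subgraph of $\Psi$ is tree-divisible, so is $\Psi$. The splitting $G|\aleph=G^\aleph$ of a tree-divisible $G$ is the directed graph with vertex set $\aleph$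 having an arc $({\tt X},{\tt Y})$, ${\tt X}\ne{\tt Y}$, iff ${\cal T}_{\tt XY}(G)\ne\emptyset$. For a tree-divisible $F\in{\cal F}^k(\Psi)$, a spanning entering forest $F'$ of $\Psi|\aleph$ is called a representative of $F$ (and $F$ a principal of $F'$) if the arc set of $F'$ equals the arc set of $F^\aleph$. -}

module Defs where

open import Data.Nat using (ℕ; suc)
open import Data.Fin using (Fin; _≟_)
open import Data.Fin.Subset using (Subset; _∈_; _⊂_; ∣_∣; ⊤; ⊥; _∩_)
open import Data.Fin.Subset.Properties using (_∈?_)
open import Data.Vec using (Vec; lookup; tabulate)
open import Data.Bool using (if_then_else_)
open import Data.Product using (Σ; ∃; _×_)
open import Relation.Nullary using (¬_; does)
open import Relation.Binary.PropositionalEquality using (_≡_; _≢_)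
open import Relation.Binary.Construct.Closure.Transitive using (TransClosure)
open import Function.Bundles using (_⇔_)

-- Host directed graphs on the vertex set Fin n (all vertices present):
-- just an arc relation.  (Weights play no role in the statement.)

ArcRel : ℕ → Set₁
ArcRel n = Fin n → Fin n → Set

-- Finite (sub)graphs with vertices among Fin n: a vertex subset and,
-- for every vertex u, the subset of heads v of arcs (u , v).

record Graph (n : ℕ) : Set where
  constructor graph
  field
    verts : Subset n
    out   : Vec (Subset n) n
open Graph public

Arc : ∀ {n} → Graph n → ArcRel n
Arc G u v = v ∈ lookup (out G) u

SubgraphOf : ∀ {n} → ArcRel n → Graph n → Set
SubgraphOf R H = ∀ {u v} → Arc H u v → R u v × u ∈ verts H × v ∈ verts H

induced : ∀ {n} → Graph n → Subset n → Graph n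
induced H D = graph (verts H ∩ D)
  (tabulate λ u → if does (u ∈? D) then lookup (out H) u ∩ D else ⊥)

OutDegAtMostOne : ∀ {n} → Graph n → Set
OutDegAtMostOne H = ∀ {u v w} → Arc H u v → Arc H u w → v ≡ w

NoDirectedCycle : ∀ {n} → Graph n → Set
NoDirectedCycle H = ∀ v → ¬ TransClosure (Arc H) v v

EnteringForest : ∀ {n} → Graph n → Set
EnteringForest H = OutDegAtMostOne H × NoDirectedCycle H

IsRoot : ∀ {n} → Graph n → Fin n → Set
IsRoot H v = v ∈ verts H × (∀ w → ¬ Arc H v w)

-- the forest consists of exactly k trees (= has exactly k roots,
-- each tree having exactly one root)
NumTrees : ∀ {n} → Graph n → ℕ → Set
NumTrees {n} H k = Σ (Subset n) λ Rs → (∀ v → (v ∈ Rs) ⇔ IsRoot H v) × ∣ Rs ∣ ≡ k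

EnteringTree : ∀ {n} → Graph n → Set
EnteringTree H = EnteringForest H × NumTrees H 1

SpanningForest : ∀ {n} → ArcRel n → ℕ → Graph n → Set
SpanningForest R k F = SubgraphOf R F × verts F ≡ ⊤ × EnteringForest F × NumTrees F k

-- Partitions ℵ of Fin n into m (nonempty) blocks, given by a
-- surjective block map p : Fin n → Fin m; block X = p⁻¹(X).

block : ∀ {n m} → (Fin n → Fin m) → Fin m → Subset n
block p X = tabulate λ v → does (p v ≟ X)

Tbullet : ∀ {n} → ArcRel n → Subset n → Graph n → Set
Tbullet R D T = SubgraphOf R T × EnteringTree T × verts T ≡ D

Tcirc : ∀ {n} → ArcRel n → Subset n → Graph n → Set
Tcirc R D T = SubgraphOf R T × EnteringTree T × D ⊂ verts T
  × ∣ verts T ∣ ≡ suc ∣ D ∣ × Tbullet R D (induced T D)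

Txy : ∀ {n m} → ArcRel n → (Fin n → Fin m) → Fin m → Fin m → Graph n → Set
Txy R p X Y T = Tcirc R (block p X) T × ∃ λ r → IsRoot T r × r ∈ block p Y

TreeDivisible : ∀ {n m} → ArcRel n → (Fin n → Fin m) → Set
TreeDivisible R p = ∀ X → ∃ λ T → Tbullet R (block p X) T

-- arcs of the splitting R|ℵ = R^ℵ (vertex set Fin m, i.e. ℵ)
Splitting : ∀ {n m} → ArcRel n → (Fin n → Fin m) → ArcRel m
Splitting R p X Y = X ≢ Y × ∃ λ T → Txy R p X Y T

-- F' is a representative of F (F' a spanning entering forest of Ψ|ℵ
-- whose arc set equals that of F^ℵ)
Representative : ∀ {n m} → ArcRel n → (Fin n → Fin m) → Graph n → Graph m → Set
Representative Ψ p F F' =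
  (∃ λ j → SpanningForest (Splitting Ψ p) j F')
  × (∀ X Y → Arc F' X Y ⇔ Splitting (Arc F) p X Y)

{-# OPTIONS --safe #-}
module Submission where

-- Each block X carries a subtree of F with root ρ X, so every other vertex of X has its F-arc
-- inside X; the F-arc out of ρ X, if any, leaves X, for otherwise X would be closed under
-- F-successors and F would have a cycle.  A tree of 𝒯_XY(F) consists of X and one further
-- vertex, which must be the head of the arc out of ρ X; hence F^ℵ has an arc X → Y exactly
-- when that arc ends in Y, i.e. F^ℵ is F with every block contracted.  Out-degrees stay at
-- most one, a cycle of F^ℵ lifts to a closed walk of F, and since every root of F is the root
-- of its block, X ↦ ρ X matches the roots of F^ℵ with the k roots of F.  A representative is
-- determined by its arc set, hence unique.

open import Defs
open import Data.Nat using (ℕ; zero; suc; _≤_; _<′_; z≤n; s≤s; ≤′-refl; ≤′-step)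
open import Data.Nat.Properties using (≤-trans; ≤-antisym; <-irrefl; n<1+n; <⇒<′)
open import Data.Fin using (Fin; zero; suc; _≟_; toℕ)
open import Data.Fin.Properties using (any?; pigeonhole; suc-injective; 0≢1+n)
open import Data.Fin.Subset using (Subset; _∈_; _∉_; _⊆_; ∣_∣; ⊤; ⁅_⁆; _∪_; _∩_; _-_; inside; outside; Nonempty)
  renaming (⊥ to ∅)
open import Data.Fin.Subset.Properties
  using (_∈?_; ∉⊥; ⊥⊆; ∈⊤; ∣⊥∣≡0; x∈⁅x⁆; x∈⁅y⁆⇒x≡y; x∈⁅y⁆⇔x≡y; ∣⁅x⁆∣≡1; ⊆-antisym; p⊂q⇒∣p∣<∣q∣;
         x∈p∪q⁻; x∈p∪q⁺; x∈p∩q⁻; x∈p∩q⁺; ∪-identityʳ; ∩-comm; ∩-abs-∪; x∈p⇒∣p-x∣<∣p∣; x∈p∧x≢y⇒x∈p-y;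
         nonempty?; Empty-unique)
open import Data.Vec using (_∷_; []; here; there; lookup; tabulate)
open import Data.Vec.Properties using (lookup∘tabulate; tabulate∘lookup; tabulate-cong; []=⇒lookup; lookup⇒[]=)
open import Data.Bool using (if_then_else_)
open import Data.Sum using (_⊎_; inj₁; inj₂; [_,_]′)
open import Data.Product using (∃; ∃!; Σ; _×_; _,_; proj₁; proj₂; map₁)
open import Function using (_∘_)
open import Function.Definitions using (Surjective)
open import Function.Bundles using (_⇔_; mk⇔; Equivalence)
open import Function.Construct.Composition using (_⇔-∘_)
open import Function.Construct.Symmetry using (⇔-sym)
open import Relation.Nullary using (¬_; Dec; yes; no; does; contradiction)
open import Relation.Nullary.Decidable using (_×-dec_; dec-true; decidable-stable)
open import Relation.Binary.PropositionalEquality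
  using (_≡_; _≢_; refl; sym; trans; cong; subst; module ≡-Reasoning)
open import Relation.Binary.Construct.Closure.Transitive using (TransClosure; [_]; _∷_; _∷ʳ_)

open Equivalence using (to; from)

∈-tabulate : ∀ {n} {P : Fin n → Set} (P? : ∀ x → Dec (P x)) {x} → x ∈ tabulate (does ∘ P?) ⇔ P x
∈-tabulate {P = P} P? {x} = mk⇔ to′ from′
  where
  to′ : x ∈ tabulate (does ∘ P?) → P x
  to′ x∈ with P? x | trans (sym (lookup∘tabulate (does ∘ P?) x)) ([]=⇒lookup x∈)
  ... | yes Px | _ = Px
  ... | no _ | ()
  from′ : P x → x ∈ tabulate (does ∘ P?)
  from′ Px = lookup⇒[]= x _ (trans (lookup∘tabulate (does ∘ P?) x) (dec-true (P? x) Px))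

∈-block : ∀ {n m} (p : Fin n → Fin m) {X v} → v ∈ block p X ⇔ p v ≡ X
∈-block p {X} = ∈-tabulate (λ v → p v ≟ X)

∣p∪⁅x⁆∣≡1+∣p∣ : ∀ {n} (p : Subset n) {x} → x ∉ p → ∣ p ∪ ⁅ x ⁆ ∣ ≡ suc ∣ p ∣
∣p∪⁅x⁆∣≡1+∣p∣ (inside ∷ p) {zero} x∉p = contradiction here x∉p
∣p∪⁅x⁆∣≡1+∣p∣ (outside ∷ p) {zero} x∉p = cong (suc ∘ ∣_∣) (∪-identityʳ p)
∣p∪⁅x⁆∣≡1+∣p∣ (inside ∷ p) {suc x} x∉p = cong suc (∣p∪⁅x⁆∣≡1+∣p∣ p (x∉p ∘ there))
∣p∪⁅x⁆∣≡1+∣p∣ (outside ∷ p) {suc x} x∉p = ∣p∪⁅x⁆∣≡1+∣p∣ p (x∉p ∘ there)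

outside-unique : ∀ {n} {p q : Subset n} → p ⊆ q → ∣ q ∣ ≡ suc ∣ p ∣
  → ∀ {x y} → x ∈ q → x ∉ p → y ∈ q → y ∉ p → x ≡ y
outside-unique {p = p} {q} p⊆q ∣q∣ {x} {y} x∈q x∉p y∈q y∉p = decidable-stable (x ≟ y) λ x≢y →
  <-irrefl (trans (∣p∪⁅x⁆∣≡1+∣p∣ p x∉p) (sym ∣q∣)) (p⊂q⇒∣p∣<∣q∣ (p∪x⊆q , y , y∈q , y∉p∪x x≢y))
  where
  p∪x⊆q : p ∪ ⁅ x ⁆ ⊆ q
  p∪x⊆q z∈ = [ p⊆q , (λ z∈x → subst (_∈ q) (sym (x∈⁅y⁆⇒x≡y x z∈x)) x∈q) ]′ (x∈p∪q⁻ p ⁅ x ⁆ z∈)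
  y∉p∪x : x ≢ y → y ∉ p ∪ ⁅ x ⁆
  y∉p∪x x≢y y∈ = [ y∉p , (λ y∈x → x≢y (sym (x∈⁅y⁆⇒x≡y x y∈x))) ]′ (x∈p∪q⁻ p ⁅ x ⁆ y∈)

∣p∣≡1+k⇒Nonempty : ∀ {n k} {p : Subset n} → ∣ p ∣ ≡ suc k → Nonempty p
∣p∣≡1+k⇒Nonempty {n} {p = p} ∣p∣ = decidable-stable (nonempty? p) λ empty →
  0≢1+k (trans (sym (∣⊥∣≡0 n)) (trans (cong ∣_∣ (sym (Empty-unique empty))) ∣p∣))
  where
  0≢1+k : ∀ {k} → 0 ≢ suc k
  0≢1+k ()

injection⇒∣p∣≤∣q∣ : ∀ {n m} {p : Subset n} {q : Subset m} (f : Fin n → Fin m)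
  → (∀ {x} → x ∈ p → f x ∈ q) → (∀ {x y} → x ∈ p → y ∈ p → f x ≡ f y → x ≡ y) → ∣ p ∣ ≤ ∣ q ∣
injection⇒∣p∣≤∣q∣ {p = []} f _ _ = z≤n
injection⇒∣p∣≤∣q∣ {p = outside ∷ p} f maps inj =
  injection⇒∣p∣≤∣q∣ (f ∘ suc) (maps ∘ there) (λ x∈ y∈ e → suc-injective (inj (there x∈) (there y∈) e))
injection⇒∣p∣≤∣q∣ {p = inside ∷ p} {q} f maps inj =
  ≤-trans (s≤s (injection⇒∣p∣≤∣q∣ (f ∘ suc) maps′ inj′)) (x∈p⇒∣p-x∣<∣p∣ (maps here))
  where
  maps′ : ∀ {x} → x ∈ p → f (suc x) ∈ q - f zero
  maps′ x∈ = x∈p∧x≢y⇒x∈p-y (maps (there x∈)) (0≢1+n ∘ sym ∘ inj (there x∈) here)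
  inj′ : ∀ {x y} → x ∈ p → y ∈ p → f (suc x) ≡ f (suc y) → x ≡ y
  inj′ x∈ y∈ e = suc-injective (inj (there x∈) (there y∈) e)

TransClosure-map : ∀ {n} {R S : Fin n → Fin n → Set} → (∀ {u v} → R u v → S u v)
  → ∀ {u v} → TransClosure R u v → TransClosure S u v
TransClosure-map R⊆S [ r ] = [ R⊆S r ]
TransClosure-map R⊆S (r ∷ rs) = R⊆S r ∷ TransClosure-map R⊆S rs

cycle-rotate : ∀ {n} {R : Fin n → Fin n → Set} {u} → TransClosure R u u → ∃ λ v → R u v × TransClosure R v v
cycle-rotate [ r ] = _ , r , [ r ]
cycle-rotate (r ∷ rs) = _ , r , (rs ∷ʳ r)

successor-closed⇒empty : ∀ {n} {R : Fin n → Fin n → Set} → (∀ v → ¬ TransClosure R v v)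
  → (P : Fin n → Set) → (∀ v → P v → ∃ λ w → R v w × P w) → ∀ v → ¬ P v
successor-closed⇒empty {n} {R} acyclic P step v₀ Pv₀ =
  let (i , j , i<j , vi≡vj) = pigeonhole (n<1+n n) (vertex ∘ toℕ)
  in acyclic (vertex (toℕ i)) (subst (TransClosure R _) (sym vi≡vj) (path (<⇒<′ i<j)))
  where
  next : Σ (Fin n) P → Σ (Fin n) P
  next (u , Pu) = proj₁ (step u Pu) , proj₂ (proj₂ (step u Pu))
  walk : ℕ → Σ (Fin n) P
  walk zero = v₀ , Pv₀
  walk (suc i) = next (walk i)
  vertex : ℕ → Fin n
  vertex = proj₁ ∘ walk
  edge : ∀ i → R (vertex i) (vertex (suc i))
  edge i = proj₁ (proj₂ (step (vertex i) (proj₂ (walk i))))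
  path : ∀ {i j} → i <′ j → TransClosure R (vertex i) (vertex j)
  path {i} ≤′-refl = [ edge i ]
  path {j = suc j} (≤′-step i<j) = path i<j ∷ʳ edge j

Arc-tabulate : ∀ {n} {V : Subset n} (g : Fin n → Subset n) {u v} → Arc (graph V (tabulate g)) u v ⇔ v ∈ g u
Arc-tabulate g {u} = mk⇔ (subst (_ ∈_) (lookup∘tabulate g u)) (subst (_ ∈_) (sym (lookup∘tabulate g u)))

Arc-induced : ∀ {n} (H : Graph n) (D : Subset n) {u v} → Arc (induced H D) u v ⇔ (u ∈ D × Arc H u v × v ∈ D)
Arc-induced H D {u} {v} =
  mk⇔ to′ from′ ⇔-∘ Arc-tabulate {V = verts H ∩ D} (λ u → if does (u ∈? D) then lookup (out H) u ∩ D else ∅)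
  where
  to′ : v ∈ (if does (u ∈? D) then lookup (out H) u ∩ D else ∅) → u ∈ D × Arc H u v × v ∈ D
  to′ v∈ with u ∈? D
  ... | yes u∈D = u∈D , x∈p∩q⁻ _ _ v∈
  ... | no _ = contradiction v∈ ∉⊥
  from′ : u ∈ D × Arc H u v × v ∈ D → v ∈ (if does (u ∈? D) then lookup (out H) u ∩ D else ∅)
  from′ (u∈D , a , v∈D) with u ∈? D
  ... | yes _ = x∈p∩q⁺ (a , v∈D)
  ... | no u∉D = contradiction u∈D u∉D

Graph-ext : ∀ {n} {G H : Graph n} → verts G ≡ verts H → (∀ u v → Arc G u v ⇔ Arc H u v) → G ≡ H
Graph-ext {G = graph V outG} {graph .V outH} refl arcs = cong (graph V) (begin
  outG                   ≡⟨ sym (tabulate∘lookup outG) ⟩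
  tabulate (lookup outG) ≡⟨ tabulate-cong (λ u → ⊆-antisym (to (arcs u _)) (from (arcs u _))) ⟩
  tabulate (lookup outH) ≡⟨ tabulate∘lookup outH ⟩
  outH                   ∎)
  where open ≡-Reasoning

¬IsRoot⇒arc : ∀ {n} {H : Graph n} {v} → v ∈ verts H → ¬ IsRoot H v → ∃ (Arc H v)
¬IsRoot⇒arc {H = H} {v} v∈ ¬root =
  decidable-stable (any? (_∈? lookup (out H) v)) λ noArc → ¬root (v∈ , λ w a → noArc (w , a))

uniqueRoot : ∀ {n} {H : Graph n} → NumTrees H 1 → ∃! _≡_ (IsRoot H)
uniqueRoot {n} (roots , roots⇔ , ∣roots∣≡1) with ∣p∣≡1+k⇒Nonempty ∣roots∣≡1
... | r , r∈ = r , to (roots⇔ r) r∈ , λ {v} root →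
  outside-unique ⊥⊆ (trans ∣roots∣≡1 (cong suc (sym (∣⊥∣≡0 n)))) r∈ ∉⊥ (from (roots⇔ v) root) ∉⊥

uniqueSink⇒NumTrees1 : ∀ {n} {H : Graph n} {r} → IsRoot H r
  → (∀ v → v ∈ verts H → v ≢ r → ∃ (Arc H v)) → NumTrees H 1
uniqueSink⇒NumTrees1 {H = H} {r} root arc = ⁅ r ⁆ , (λ v → root⇔≡r ⇔-∘ x∈⁅y⁆⇔x≡y) , ∣⁅x⁆∣≡1 r
  where
  root⇔≡r : ∀ {v} → v ≡ r ⇔ IsRoot H v
  root⇔≡r {v} = mk⇔ (λ { refl → root })
    (λ { (v∈ , noArc) → decidable-stable (v ≟ r) λ v≢r → let (w , a) = arc v v∈ v≢r in noArc w a })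

EnteringForest-mono : ∀ {n} {G H : Graph n} → (∀ {u v} → Arc H u v → Arc G u v)
  → EnteringForest G → EnteringForest H
EnteringForest-mono H⊆G (outDeg , acyclic) =
  (λ a b → outDeg (H⊆G a) (H⊆G b)) , λ v cycle → acyclic v (TransClosure-map H⊆G cycle)

uniqueSink⇒EnteringTree : ∀ {n} {G H : Graph n} {r} → EnteringForest G → SubgraphOf (Arc G) H
  → IsRoot H r → (∀ v → v ∈ verts H → v ≢ r → ∃ (Arc H v)) → EnteringTree H
uniqueSink⇒EnteringTree {G = G} {H} forest H⊆G root arc =
  EnteringForest-mono {G = G} {H} (proj₁ ∘ H⊆G) forest , uniqueSink⇒NumTrees1 {H = H} root arc

Tbullet⇒sink : ∀ {n} {R : ArcRel n} {D T} → Tbullet R D T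
  → ∃ λ r → r ∈ D × (∀ v → v ∈ D → v ≢ r → ∃ λ w → R v w × w ∈ D)
Tbullet⇒sink {T = T} (T⊆R , (_ , oneTree) , refl) with uniqueRoot {H = T} oneTree
... | r , (r∈ , _) , unique = r , r∈ , λ v v∈ v≢r →
  let (w , a) = ¬IsRoot⇒arc {H = T} v∈ (λ root → v≢r (sym (unique root)))
      (r-arc , _ , w∈) = T⊆R a
  in w , r-arc , w∈

NumTrees-bijection : ∀ {n m k} {G : Graph n} {H : Graph m} (ρ : Fin m → Fin n) (π : Fin n → Fin m)
  → (∀ X → IsRoot G (ρ X) ⇔ IsRoot H X) → (∀ X → π (ρ X) ≡ X) → (∀ v → IsRoot G v → ρ (π v) ≡ v)
  → NumTrees G k → NumTrees H k
NumTrees-bijection ρ π root⇔ πρ ρπ (roots , roots⇔ , ∣roots∣≡k) =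
  roots′ , (λ X → root⇔ X ⇔-∘ (roots⇔ (ρ X) ⇔-∘ ∈roots′)) , trans (≤-antisym ∣roots′∣≤ ∣roots∣≤) ∣roots∣≡k
  where
  roots′ = tabulate (does ∘ λ X → ρ X ∈? roots)
  ∈roots′ : ∀ {X} → X ∈ roots′ ⇔ ρ X ∈ roots
  ∈roots′ = ∈-tabulate (λ X → ρ X ∈? roots)
  ρπ∈ : ∀ {v} → v ∈ roots → ρ (π v) ≡ v
  ρπ∈ {v} v∈ = ρπ v (to (roots⇔ v) v∈)
  ∣roots′∣≤ : ∣ roots′ ∣ ≤ ∣ roots ∣
  ∣roots′∣≤ = injection⇒∣p∣≤∣q∣ ρ (to ∈roots′) (λ {X} {Y} _ _ e → trans (sym (πρ X)) (trans (cong π e) (πρ Y)))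
  ∣roots∣≤ : ∣ roots ∣ ≤ ∣ roots′ ∣
  ∣roots∣≤ = injection⇒∣p∣≤∣q∣ π (λ v∈ → from ∈roots′ (subst (_∈ roots) (sym (ρπ∈ v∈)) v∈))
    (λ v∈ w∈ e → trans (sym (ρπ∈ v∈)) (trans (cong ρ e) (ρπ∈ w∈)))

Splitting-mono : ∀ {n m} {R S : ArcRel n} {p : Fin n → Fin m} → (∀ {u v} → R u v → S u v)
  → ∀ {X Y} → Splitting R p X Y → Splitting S p X Y
Splitting-mono {R = R} {S} {p} R⊆S {X} (X≢Y , T , (T⊆R , tree , X⊂ , card , (I⊆R , treeI , vertsI)) , root) =
  X≢Y , T , (mono {T} T⊆R , tree , X⊂ , card , (mono {induced T (block p X)} I⊆R , treeI , vertsI)) , root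
  where
  mono : ∀ {H} → SubgraphOf R H → SubgraphOf S H
  mono H⊆R a = map₁ R⊆S (H⊆R a)

module Contraction {n m} (p : Fin n → Fin m) (F : Graph n) (forest : EnteringForest F)
                   (divisible : TreeDivisible (Arc F) p) where

  private
    outDeg : OutDegAtMostOne F
    outDeg = proj₁ forest

    acyclic : NoDirectedCycle F
    acyclic = proj₂ forest

    sink : ∀ X → ∃ λ r → r ∈ block p X × (∀ v → v ∈ block p X → v ≢ r → ∃ λ w → Arc F v w × w ∈ block p X)
    sink X = Tbullet⇒sink {T = proj₁ (divisible X)} (proj₂ (divisible X))

  blockRoot : Fin m → Fin n
  blockRoot X = proj₁ (sink X)

  p-blockRoot : ∀ X → p (blockRoot X) ≡ X
  p-blockRoot X = to (∈-block p) (proj₁ (proj₂ (sink X)))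

  arc-within-block : ∀ {X v} → p v ≡ X → v ≢ blockRoot X → ∃ λ w → Arc F v w × p w ≡ X
  arc-within-block {X} {v} pv≡X v≢r =
    let (w , a , w∈) = proj₂ (proj₂ (sink X)) v (from (∈-block p) pv≡X) v≢r in w , a , to (∈-block p) w∈

  blockRoot-exits : ∀ {X w} → Arc F (blockRoot X) w → p w ≢ X
  blockRoot-exits {X} {w} a pw≡X =
    successor-closed⇒empty acyclic (λ u → p u ≡ X) stay (blockRoot X) (p-blockRoot X)
    where
    stay : ∀ u → p u ≡ X → ∃ λ v → Arc F u v × p v ≡ X
    stay u pu≡X with u ≟ blockRoot X
    ... | yes refl = w , a , pw≡X
    ... | no u≢r = arc-within-block pu≡X u≢r

  sink⇒blockRoot : ∀ {v} → (∀ w → ¬ Arc F v w) → v ≡ blockRoot (p v)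
  sink⇒blockRoot {v} noArc = decidable-stable (v ≟ blockRoot (p v)) λ v≢r →
    let (w , a , _) = arc-within-block refl v≢r in noArc w a

  Exit : Fin m → Fin m → Set
  Exit X Y = ∃ λ w → Arc F (blockRoot X) w × p w ≡ Y

  exit? : ∀ X Y → Dec (Exit X Y)
  exit? X Y = any? λ w → (w ∈? lookup (out F) (blockRoot X)) ×-dec (p w ≟ Y)

  Exit-functional : ∀ {X Y Z} → Exit X Y → Exit X Z → Y ≡ Z
  Exit-functional (w , a , refl) (w′ , a′ , refl) = cong p (outDeg a a′)

  Exit⇒≢ : ∀ {X Y} → Exit X Y → X ≢ Y
  Exit⇒≢ (w , a , pw≡Y) X≡Y = blockRoot-exits a (trans pw≡Y (sym X≡Y))

  Splitting⇒Exit : ∀ {X Y} → Splitting (Arc F) p X Y → Exit X Y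
  Splitting⇒Exit {X} {Y} (X≢Y , T , (T⊆F , (_ , oneTree) , (X⊆T , _) , ∣T∣ , _) , r , r-root , r∈Y) =
    let (w , a) = ¬IsRoot⇒arc {H = T} (X⊆T ρ∈X) ρ-not-root
        (F-arc , _ , w∈T) = T⊆F a
        w≡r = outside-unique X⊆T ∣T∣ w∈T (blockRoot-exits F-arc ∘ to (∈-block p)) (proj₁ r-root) r∉X
    in w , F-arc , trans (cong p w≡r) pr≡Y
    where
    pr≡Y : p r ≡ Y
    pr≡Y = to (∈-block p) r∈Y
    ρ∈X : blockRoot X ∈ block p X
    ρ∈X = from (∈-block p) (p-blockRoot X)
    r∉X : r ∉ block p X
    r∉X r∈X = X≢Y (trans (sym (to (∈-block p) r∈X)) pr≡Y)
    ρ-not-root : ¬ IsRoot T (blockRoot X)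
    ρ-not-root ρ-root = let (_ , _ , unique) = uniqueRoot {H = T} oneTree in
      r∉X (subst (_∈ block p X) (trans (sym (unique ρ-root)) (unique r-root)) ρ∈X)

  module ExitTree {X w} (exit : Arc F (blockRoot X) w) where

    T : Graph n
    T = graph (block p X ∪ ⁅ w ⁆) (tabulate λ u → if does (p u ≟ X) then lookup (out F) u else ∅)

    Arc-T : ∀ {u v} → Arc T u v ⇔ (p u ≡ X × Arc F u v)
    Arc-T {u} {v} =
      mk⇔ to′ from′ ⇔-∘ Arc-tabulate {V = verts T} (λ u → if does (p u ≟ X) then lookup (out F) u else ∅)
      where
      to′ : v ∈ (if does (p u ≟ X) then lookup (out F) u else ∅) → p u ≡ X × Arc F u v
      to′ v∈ with p u ≟ X
      ... | yes pu≡X = pu≡X , v∈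
      ... | no _ = contradiction v∈ ∉⊥
      from′ : p u ≡ X × Arc F u v → v ∈ (if does (p u ≟ X) then lookup (out F) u else ∅)
      from′ (pu≡X , a) with p u ≟ X
      ... | yes _ = a
      ... | no pu≢X = contradiction pu≡X pu≢X

    w∉X : w ∉ block p X
    w∉X = blockRoot-exits exit ∘ to (∈-block p)

    w∈T : w ∈ verts T
    w∈T = x∈p∪q⁺ (inj₂ (x∈⁅x⁆ w))

    X⊆T : block p X ⊆ verts T
    X⊆T = x∈p∪q⁺ ∘ inj₁

    w-root : IsRoot T w
    w-root = w∈T , λ v a → w∉X (from (∈-block p) (proj₁ (to Arc-T a)))

    arc-from-block : ∀ {u v} → p u ≡ X → Arc F u v → v ≡ w ⊎ p v ≡ X
    arc-from-block {u} {v} pu≡X a with u ≟ blockRoot X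
    ... | yes refl = inj₁ (outDeg a exit)
    ... | no u≢r = let (v′ , a′ , pv′≡X) = arc-within-block pu≡X u≢r
                   in inj₂ (subst (λ z → p z ≡ X) (outDeg a′ a) pv′≡X)

    T⊆F : SubgraphOf (Arc F) T
    T⊆F a with to Arc-T a
    ... | pu≡X , a′ = a′ , X⊆T (from (∈-block p) pu≡X) ,
      [ (λ { refl → w∈T }) , X⊆T ∘ from (∈-block p) ]′ (arc-from-block pu≡X a′)

    T-tree : EnteringTree T
    T-tree = uniqueSink⇒EnteringTree {G = F} {T} forest T⊆F w-root arc
      where
      arc : ∀ v → v ∈ verts T → v ≢ w → ∃ (Arc T v)
      arc v v∈ v≢w with x∈p∪q⁻ (block p X) ⁅ w ⁆ v∈
      ... | inj₂ v∈w = contradiction (x∈⁅y⁆⇒x≡y w v∈w) v≢w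
      ... | inj₁ v∈X with v ≟ blockRoot X
      ...   | yes refl = w , from Arc-T (to (∈-block p) v∈X , exit)
      ...   | no v≢r = let (v′ , a , _) = arc-within-block (to (∈-block p) v∈X) v≢r
                       in v′ , from Arc-T (to (∈-block p) v∈X , a)

    I : Graph n
    I = induced T (block p X)

    verts-I : verts I ≡ block p X
    verts-I = trans (∩-comm (verts T) (block p X)) (∩-abs-∪ (block p X) ⁅ w ⁆)

    ∈I : ∀ {v} → p v ≡ X → v ∈ verts I
    ∈I pv≡X = subst (_ ∈_) (sym verts-I) (from (∈-block p) pv≡X)

    Arc-I : ∀ {u v} → Arc I u v ⇔ (p u ≡ X × Arc F u v × p v ≡ X)
    Arc-I = mk⇔ (λ (u∈ , a , v∈) → to (∈-block p) u∈ , proj₂ (to Arc-T a) , to (∈-block p) v∈)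
                (λ (pu , a , pv) → from (∈-block p) pu , from Arc-T (pu , a) , from (∈-block p) pv)
            ⇔-∘ Arc-induced T (block p X)

    I⊆F : SubgraphOf (Arc F) I
    I⊆F a = let (pu , a′ , pv) = to Arc-I a in a′ , ∈I pu , ∈I pv

    I-tree : EnteringTree I
    I-tree = uniqueSink⇒EnteringTree {G = F} {I} forest I⊆F
      (∈I (p-blockRoot X) , λ v a → let (_ , a′ , pv) = to Arc-I a in blockRoot-exits a′ pv) arc
      where
      arc : ∀ v → v ∈ verts I → v ≢ blockRoot X → ∃ (Arc I v)
      arc v v∈ v≢r = let pv = to (∈-block p) (subst (_ ∈_) verts-I v∈)
                         (v′ , a , pv′) = arc-within-block pv v≢r
                     in v′ , from Arc-I (pv , a , pv′)

    T-Tcirc : Tcirc (Arc F) (block p X) T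
    T-Tcirc = T⊆F , T-tree , (X⊆T , w , w∈T , w∉X) , ∣p∪⁅x⁆∣≡1+∣p∣ (block p X) w∉X , (I⊆F , I-tree , verts-I)

  Exit⇒Splitting : ∀ {X Y} → Exit X Y → Splitting (Arc F) p X Y
  Exit⇒Splitting {X} {Y} e@(w , exit , pw≡Y) = Exit⇒≢ e , T , (T-Tcirc , w , w-root , from (∈-block p) pw≡Y)
    where open ExitTree {X} {w} exit

  contracted : Graph m
  contracted = graph ⊤ (tabulate λ X → tabulate (does ∘ exit? X))

  Arc-contracted : ∀ X Y → Arc contracted X Y ⇔ Exit X Y
  Arc-contracted X Y = ∈-tabulate (exit? X) ⇔-∘ Arc-tabulate {V = ⊤} (λ X → tabulate (does ∘ exit? X))

  Arc-contracted⇔Splitting : ∀ X Y → Arc contracted X Y ⇔ Splitting (Arc F) p X Y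
  Arc-contracted⇔Splitting X Y =
    mk⇔ (Exit⇒Splitting ∘ to (Arc-contracted X Y)) (from (Arc-contracted X Y) ∘ Splitting⇒Exit)

  -- A cycle of the contraction lifts to a closed walk of F: inside a block follow the
  -- tree towards the block root, and from a block root take its exit arc.
  contracted-acyclic : NoDirectedCycle contracted
  contracted-acyclic X cycle =
    successor-closed⇒empty acyclic OnCycle lift (blockRoot X) (subst Cycle (sym (p-blockRoot X)) cycle)
    where
    Cycle : Fin m → Set
    Cycle Z = TransClosure (Arc contracted) Z Z
    OnCycle : Fin n → Set
    OnCycle v = Cycle (p v)
    lift : ∀ v → OnCycle v → ∃ λ w → Arc F v w × OnCycle w
    lift v c with v ≟ blockRoot (p v)
    ... | no v≢r = let (w , a , pw) = arc-within-block refl v≢r in w , a , subst Cycle (sym pw) c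
    ... | yes v≡r = let (_ , a′ , c′) = cycle-rotate c
                        (w , a , pw) = to (Arc-contracted (p v) _) a′
                    in w , subst (λ z → Arc F z w) (sym v≡r) a , subst Cycle (sym pw) c′

  contracted-forest : EnteringForest contracted
  contracted-forest =
    (λ {X} {Y} {Z} a b → Exit-functional (to (Arc-contracted X Y) a) (to (Arc-contracted X Z) b)) ,
    contracted-acyclic

  IsRoot-contracted : verts F ≡ ⊤ → ∀ X → IsRoot F (blockRoot X) ⇔ IsRoot contracted X
  IsRoot-contracted spanning X = mk⇔
    (λ (_ , noArc) → ∈⊤ , λ Y a → let (w , a′ , _) = to (Arc-contracted X Y) a in noArc w a′)
    (λ (_ , noArc) → subst (blockRoot X ∈_) (sym spanning) ∈⊤ ,
                     λ w a → noArc (p w) (from (Arc-contracted X (p w)) (w , a , refl)))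

  contracted-NumTrees : ∀ {k} → verts F ≡ ⊤ → NumTrees F k → NumTrees contracted k
  contracted-NumTrees spanning =
    NumTrees-bijection {G = F} {contracted} blockRoot p (IsRoot-contracted spanning) p-blockRoot
      (λ v root → sym (sink⇒blockRoot (proj₂ root)))

proposition4 : ∀ {n m} (Ψ : ArcRel n) (p : Fin n → Fin m) → Surjective _≡_ _≡_ p
    → (k : ℕ) (F : Graph n) → SpanningForest Ψ k F → TreeDivisible (Arc F) p
    → ∃! _≡_ (Representative Ψ p F)
    × (∀ F' → Representative Ψ p F F' → SpanningForest (Splitting Ψ p) k F')
proposition4 Ψ p _ k F (F⊆Ψ , spanning , forest , trees) divisible =
  (contracted , representative , unique) ,
  λ F′ r → subst (SpanningForest (Splitting Ψ p) k) (unique {F′} r) contracted-spans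
  where
  open Contraction p F forest divisible
  contracted-spans : SpanningForest (Splitting Ψ p) k contracted
  contracted-spans =
    (λ {X} {Y} a → Splitting-mono {p = p} (proj₁ ∘ F⊆Ψ) (to (Arc-contracted⇔Splitting X Y) a) , ∈⊤ , ∈⊤) ,
    refl , contracted-forest , contracted-NumTrees spanning trees
  representative : Representative Ψ p F contracted
  representative = (k , contracted-spans) , Arc-contracted⇔Splitting
  unique : ∀ {F′} → Representative Ψ p F F′ → contracted ≡ F′
  unique ((_ , _ , verts≡⊤ , _) , arcs) =
    Graph-ext (sym verts≡⊤) λ X Y → ⇔-sym (arcs X Y) ⇔-∘ Arc-contracted⇔Splitting X Y
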